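{- Let $\mathcal{M}=(Q,\Gamma,\Delta,q_0,\gamma_0)$ be a DCFS and $k\in\mathbb{N}$. Let $\mathcal{M}'=(Q,\Gamma',\Delta',q_0,(\gamma_0,0))$ be the DCFS with stack alphabet $\Gamma'=\Gamma_\epsilon\times[0,k+1]$ and with $\Delta'$ the smallest set such that for every $i\in[0,k]$: (1) if $\langle q,\gamma\rangle\to\langle q',u\rangle\rhd\epsilon$ is in $\Delta$ then $\langle q,(\gamma,i)\rangle\to\langle q',(u,i)\rangle\rhd\epsilon$ is in $\Delta'$; (2) if $\langle q,\gamma\rangle\to\langle q',u\rangle\rhd\alpha$ is in $\Delta$ with $\alpha\in\Gamma$ then $\langle q,(\gamma,i)\rangle\to\langle q',(u,i)\rangle\rhd(\alpha,i+1)$ is in $\Delta'$; (3) if $\langle q,\gamma\rangle\mapsto\langle q',u\rangle$ is in $\Delta$ then $\langle q,(\gamma,i)\rangle\mapsto\langle q',(u,i+1)\rangle$ is in $\Delta'$; (4) if $q\mapsto q'\lhd\gamma$ is in $\Delta$ then $q\mapsto q'\lhd(\gamma,i)$ is in $\Delta'$. (Here $(u,i)$ with $u\in\Gamma_\epsilon$ denotes a single stack symbol of $\Gamma'$.) Then for every $q\in Q$: $q$ is $k$-bounded reachable by $\mathcal{M}$ if and only if $q$ is reachable by $\mathcal{M}'$.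
   Context: A DCPS is a tuple $(Q,\Gamma,\Delta,q_0,\gamma_0)$: $Q$ finite non-empty set of states, $\Gamma$ finite stack alphabet, $q_0\in Q$, $\gamma_0\in\Gamma$, $\Delta$ consisting of creation rules $\langle q,\gamma\rangle\to\langle q',u\rangle\rhd\alpha$ ($u\in\Gamma^{\le 2}=\Gamma_\epsilon\cup\Gamma^2$, $\alpha\in\Gamma_\epsilon=\Gamma\cup\{\epsilon\}$), interruption rules $\langle q,\gamma\rangle\mapsto\langle q',u\rangle$, and resumption rules $q\mapsto q'\lhd\gamma$. A DCFS is a DCPS in which every creation and interruption rule has $|u|\le 1$. Local configurations are $(w,i)\in\Gamma^*\times\mathbb{N}$ (set $\mathit{Loc}$); configurations are $(q,\eta,\mathit{Val})$ with $q\in Q$, $\eta\in\mathit{Loc}\cup\{\bot\}$ (active thread), $\mathit{Val}:\mathit{Loc}\to\mathbb{N}$ (pending threads); $\mathbf{1}_x$ maps $x$ to $1$, all else to $0$. Initial configuration $(q_0,\bot,\mathbf{1}_{(\gamma_0,0)})$. Steps: creation $(q,(\gamma w,i),\mathit{Val})\to(q',(uw,i),\mathit{Val}')$ with $\mathit{Val}'=\mathit{Val}+\mathbf{1}_{(\alpha,i+1)}$ if $\alpha\in\Gamma$, else $\mathit{Val}'=\mathit{Val}$; interruption $(q,(\gamma w,i),\mathit{Val})\to(q',\bot,\mathit{Val}+\mathbf{1}_{(uw,i+1)})$; resumption $(q,\bot,\mathit{Val}+\mathbf{1}_{(\gamma w,i)})\to(q',(\gamma w,i),\mathit{Val})$.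 A state $q$ is reachable by a DCPS if some configuration with no active thread ($\eta=\bot$) and state $q$ is reachable from the initial configuration. A step $c\to c'$ is $[0,k]$-bounded if the active thread of $c$ or of $c'$ exists and has switch number in $[0,k]$; $q$ is $k$-bounded reachable if such a configuration is reachable using only $[0,k]$-bounded steps. -}

module Defs where

open import Data.Nat using (ℕ; zero; suc; _≤_)
open import Data.Fin using (Fin; inject₁) renaming (zero to fzero; suc to fsuc)
open import Data.List using (List; []; _∷_; _++_)
open import Data.Maybe using (Maybe; just; nothing)
open import Data.Product using (_×_; _,_; Σ; ∃)
open import Data.Sum using (_⊎_)
open import Data.Empty using (⊥)
open import Function.Bundles using (_↔_)
open import Relation.Binary.PropositionalEquality using (_≡_; _≢_)
open import Relation.Binary.Construct.Closure.ReflexiveTransitive using (Star)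

Finite : Set → Set
Finite A = Σ ℕ λ n → A ↔ Fin n

data U≤2 (Γ : Set) : Set where
  ε    : U≤2 Γ
  one : Γ → U≤2 Γ
  two : Γ → Γ → U≤2 Γ

toList : {Γ : Set} → U≤2 Γ → List Γ
toList ε = []
toList (one a) = a ∷ []
toList (two a b) = a ∷ b ∷ []

fromΓε : {Γ : Set} → Maybe Γ → U≤2 Γ
fromΓε nothing = ε
fromΓε (just a) = one a

-- Rules.  create q γ q' u α   : ⟨q,γ⟩ → ⟨q',u⟩ ▷ α   (α = nothing means ε)
--         interrupt q γ q' u  : ⟨q,γ⟩ ↦ ⟨q',u⟩
--         resume q q' γ       : q ↦ q' ◁ γ
data Rule (Q Γ : Set) : Set where
  create    : Q → Γ → Q → U≤2 Γ → Maybe Γ → Rule Q Γ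
  interrupt : Q → Γ → Q → U≤2 Γ → Rule Q Γ
  resume    : Q → Q → Γ → Rule Q Γ

record DCPS (Q Γ : Set) : Set₁ where
  field
    Δ  : Rule Q Γ → Set
    q₀ : Q
    γ₀ : Γ

data ShortU {Γ : Set} : U≤2 Γ → Set where
  sε : ShortU ε
  s1 : ∀ a → ShortU (one a)

IsDCFS : {Q Γ : Set} → DCPS Q Γ → Set
IsDCFS {Q} {Γ} M =
  (∀ {q γ q' u α} → DCPS.Δ M (create q γ q' u α) → ShortU u) ×
  (∀ {q γ q' u} → DCPS.Δ M (interrupt q γ q' u) → ShortU u)

Loc : Set → Set
Loc Γ = List Γ × ℕ

Config : Set → Set → Set
Config Q Γ = Q × Maybe (Loc Γ) × (Loc Γ → ℕ)

AddOne : {Γ : Set} → (Loc Γ → ℕ) → Loc Γ → (Loc Γ → ℕ) → Set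
AddOne V x V' = (V' x ≡ suc (V x)) × (∀ y → y ≢ x → V' y ≡ V y)

IsOne : {Γ : Set} → Loc Γ → (Loc Γ → ℕ) → Set
IsOne x V = (V x ≡ 1) × (∀ y → y ≢ x → V y ≡ 0)

module _ {Q Γ : Set} (M : DCPS Q Γ) where
  open DCPS M

  data Step : Config Q Γ → Config Q Γ → Set where
    creation-ε : ∀ {q γ q' u w i V} →
      Δ (create q γ q' u nothing) →
      Step (q , just (γ ∷ w , i) , V) (q' , just (toList u ++ w , i) , V)
    creation-α : ∀ {q γ q' u α w i V V'} →
      Δ (create q γ q' u (just α)) →
      AddOne V (α ∷ [] , suc i) V' →
      Step (q , just (γ ∷ w , i) , V) (q' , just (toList u ++ w , i) , V')
    interruption : ∀ {q γ q' u w i V V'} →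
      Δ (interrupt q γ q' u) →
      AddOne V (toList u ++ w , suc i) V' →
      Step (q , just (γ ∷ w , i) , V) (q' , nothing , V')
    resumption : ∀ {q q' γ w i V V'} →
      Δ (resume q q' γ) →
      AddOne V' (γ ∷ w , i) V →
      Step (q , nothing , V) (q' , just (γ ∷ w , i) , V')

  ActiveIn : ℕ → Config Q Γ → Set
  ActiveIn k (q , nothing , V) = ⊥
  ActiveIn k (q , just (w , i) , V) = i ≤ k

  BoundedStep : ℕ → Config Q Γ → Config Q Γ → Set
  BoundedStep k c c' = Step c c' × (ActiveIn k c ⊎ ActiveIn k c')

  Initial : Config Q Γ → Set
  Initial (q , η , V) = (q ≡ q₀) × (η ≡ nothing) × IsOne (γ₀ ∷ [] , 0) V

  Reachable : Q → Set
  Reachable q = ∃ λ c → ∃ λ V → Initial c × Star Step c (q , nothing , V)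

  BoundedReachable : ℕ → Q → Set
  BoundedReachable k q =
    ∃ λ c → ∃ λ V → Initial c × Star (BoundedStep k) c (q , nothing , V)

module _ {Q Γ : Set} (M : DCPS Q Γ) (k : ℕ) where
  open DCPS M

  Γ' : Set
  Γ' = Maybe Γ × Fin (suc (suc k))

  data Δ' : Rule Q Γ' → Set where
    rule1 : ∀ {q γ q' u} (i : Fin (suc k)) →
      Δ (create q γ q' (fromΓε u) nothing) →
      Δ' (create q (just γ , inject₁ i) q' (one (u , inject₁ i)) nothing)
    rule2 : ∀ {q γ q' u α} (i : Fin (suc k)) →
      Δ (create q γ q' (fromΓε u) (just α)) →
      Δ' (create q (just γ , inject₁ i) q' (one (u , inject₁ i)) (just (just α , fsuc i)))
    rule3 : ∀ {q γ q' u} (i : Fin (suc k)) →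
      Δ (interrupt q γ q' (fromΓε u)) →
      Δ' (interrupt q (just γ , inject₁ i) q' (one (u , fsuc i)))
    rule4 : ∀ {q q' γ} (i : Fin (suc k)) →
      Δ (resume q q' γ) →
      Δ' (resume q q' (just γ , inject₁ i))

  M' : DCPS Q Γ'
  M' = record { Δ = Δ' ; q₀ = q₀ ; γ₀ = (just γ₀ , fzero) }

module Submission where

-- In a DCFS every stack has length at most one, so a thread of M at switch
-- number i ≤ k+1 with stack m ∈ Γ_ε is faithfully represented by the thread
-- of M' whose stack is the single symbol (m , i).  The proof is a pair of
-- step-by-step simulations, one in each direction.  The multisets of
-- pending threads are translated by pulling them back along partial
-- decodings of thread locations (`pull`, `unlabel`, `label`); a partial
-- decoding that is injective where defined turns "add one pending thread"
-- into "add one pending thread" (`pull-add`).  Each simulation keeps an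
-- invariant stating where the multiset of pending threads vanishes, which
-- guarantees that resumed threads have the expected shape.

open import Defs
open import Data.Nat using (ℕ; suc; _≤_; _≟_; _<?_; s≤s)
open import Data.Fin using (Fin; inject₁; toℕ; fromℕ<) renaming (zero to fzero; suc to fsuc)
open import Data.Fin.Properties
  using (toℕ-injective; toℕ-inject₁; toℕ-fromℕ<; fromℕ<-toℕ; toℕ<n; toℕ≤pred[n])
open import Data.List using (List; []; _∷_; _++_)
open import Data.Maybe using (Maybe; just; nothing; maybe′)
open import Data.Maybe.Properties using (just-injective)
open import Data.Product using (_×_; _,_; ∃; proj₁; proj₂)
open import Data.Sum using (inj₁; inj₂)
open import Data.Empty using (⊥-elim)
open import Function.Bundles using (_⇔_; mk⇔)
open import Relation.Nullary using (yes; no; ¬_)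
open import Relation.Binary.PropositionalEquality
open import Relation.Binary.Construct.Closure.ReflexiveTransitive using (Star; _◅_) renaming (ε to ε★)

simulate : {A B : Set} {_⟶₁_ : A → A → Set} {_⟶₂_ : B → B → Set}
           (R : A → B → Set) →
           (∀ {a a' b} → R a b → a ⟶₁ a' → ∃ λ b' → R a' b' × b ⟶₂ b') →
           ∀ {a a' b} → R a b → Star _⟶₁_ a a' → ∃ λ b' → R a' b' × Star _⟶₂_ b b'
simulate R sim r ε★ = _ , r , ε★
simulate R sim r (s ◅ ss) with sim r s
... | _ , r' , s' with simulate R sim r' ss
...   | _ , r'' , ss' = _ , r'' , s' ◅ ss'

short-letter : {Γ : Set} {u : U≤2 Γ} → ShortU u → ∃ λ m → u ≡ fromΓε m
short-letter sε = nothing , refl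
short-letter (s1 a) = just a , refl

module Counters {A : Set} where

  Vanishes : (Loc A → Set) → (Loc A → ℕ) → Set
  Vanishes P V = ∀ y → P y → V y ≡ 0

  added-outside : ∀ {P U V y} → Vanishes P V → AddOne U y V → ¬ P y
  added-outside van (at-y , _) py with () ← trans (sym at-y) (van _ py)

  vanishes-add : ∀ {P V V' y} → Vanishes P V → ¬ P y → AddOne V y V' → Vanishes P V'
  vanishes-add van ¬py (_ , off) y' py' =
    trans (off y' λ { refl → ¬py py' }) (van y' py')

  vanishes-remove : ∀ {P V V' y} → Vanishes P V → AddOne V' y V → Vanishes P V'
  vanishes-remove van ad y' py' =
    trans (sym (proj₂ ad y' λ { refl → added-outside van ad py' })) (van y' py')

  vanishes-one : ∀ {P V y} → ¬ P y → IsOne y V → Vanishes P V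
  vanishes-one ¬py (_ , off) y' py' = off y' λ { refl → ¬py py' }

  data Long : Loc A → Set where
    long : ∀ {a b w i} → Long (a ∷ b ∷ w , i)

  pending-short : ∀ {V V' a w i} → Vanishes Long V → AddOne V' (a ∷ w , i) V → w ≡ []
  pending-short {w = []} _ _ = refl
  pending-short {w = _ ∷ _} van ad = ⊥-elim (added-outside van ad long)

open Counters

module Pullback {A B : Set} (dec : Loc A → Maybe (Loc B)) where

  pull : (Loc B → ℕ) → Loc A → ℕ
  pull V x = maybe′ V 0 (dec x)

  PartialInjective : Set
  PartialInjective = ∀ {x x' y} → dec x ≡ just y → dec x' ≡ just y → x ≡ x'

  module _ (dec-inj : PartialInjective) {x : Loc A} {y : Loc B} (dx : dec x ≡ just y) where

    pull-at : ∀ V → pull V x ≡ V y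
    pull-at V = cong (maybe′ V 0) dx

    pull-off : ∀ {U V} → (∀ y' → y' ≢ y → U y' ≡ V y') →
               ∀ x' → x' ≢ x → pull U x' ≡ pull V x'
    pull-off off x' x'≢x with dec x' in dx'
    ... | nothing = refl
    ... | just y' = off y' λ { refl → x'≢x (dec-inj dx' dx) }

    pull-add : ∀ {V V'} → AddOne V y V' → AddOne (pull V) x (pull V')
    pull-add {V} {V'} (at-y , off) = at-x , pull-off off
      where
      open ≡-Reasoning
      at-x : pull V' x ≡ suc (pull V x)
      at-x = begin
        pull V' x      ≡⟨ pull-at V' ⟩
        V' y           ≡⟨ at-y ⟩
        suc (V y)      ≡⟨ cong suc (sym (pull-at V)) ⟩
        suc (pull V x) ∎

    pull-one : ∀ {V} → IsOne y V → IsOne x (pull V)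
    pull-one {V} (at-y , off) = trans (pull-at V) at-y , λ x' x'≢x →
      trans (pull-off off x' x'≢x) (pull-zero x')
      where
      pull-zero : ∀ x' → pull (λ _ → 0) x' ≡ 0
      pull-zero x' with dec x'
      ... | nothing = refl
      ... | just _ = refl

open Pullback

data InRange (k : ℕ) : ℕ → Set where
  value-of : (g : Fin (suc k)) → InRange k (toℕ g)

in-range : ∀ {k i} → i ≤ k → InRange k i
in-range i≤k = subst (InRange _) (toℕ-fromℕ< (s≤s i≤k)) (value-of (fromℕ< (s≤s i≤k)))

inject₁-level : ∀ {k i} (h : Fin (suc k)) → toℕ (inject₁ h) ≡ i → i ≤ k
inject₁-level h refl rewrite toℕ-inject₁ h = toℕ≤pred[n] h

next-level : ∀ {k i} (h : Fin (suc k)) → toℕ (inject₁ h) ≡ i → toℕ (fsuc h) ≡ suc i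
next-level h e = cong suc (trans (sym (toℕ-inject₁ h)) e)

module Construction {Q Γ : Set} (M : DCPS Q Γ) (k : ℕ) where
  open DCPS M

  -- The stack of length at most one given by a letter of Γ_ε, in the form
  -- `toList u ++ w` (with w = []) in which the steps of M produce it.
  stack : Maybe Γ → List Γ
  stack m = toList (fromΓε m) ++ []

  stack-injective : ∀ {m m'} → stack m ≡ stack m' → m ≡ m'
  stack-injective {nothing} {nothing} _ = refl
  stack-injective {just a} {just .a} refl = refl

  stack-short : ∀ {m i} → ¬ Long (stack m , i)
  stack-short {nothing} ()
  stack-short {just _} ()

  unlabel : Loc (Γ' M k) → Maybe (Loc Γ)
  unlabel ((m , f) ∷ [] , j) with toℕ f ≟ j
  ... | yes _ = just (stack m , j)
  ... | no _ = nothing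
  unlabel _ = nothing

  unlabel-at : ∀ {m f j} → toℕ f ≡ j → unlabel ((m , f) ∷ [] , j) ≡ just (stack m , j)
  unlabel-at {f = f} {j} e with toℕ f ≟ j
  ... | yes _ = refl
  ... | no ne = ⊥-elim (ne e)

  unlabel-injective : PartialInjective unlabel
  unlabel-injective {((m , f) ∷ [] , j)} {((m' , f') ∷ [] , j')} dx dx'
    with toℕ f ≟ j | toℕ f' ≟ j' | dx | dx'
  ... | yes e | yes e' | refl | eq with just-injective eq
  ...   | same-loc with stack-injective (cong proj₁ same-loc) | cong proj₂ same-loc
  ...     | refl | refl = cong (λ g → ((m , g) ∷ [] , j)) (toℕ-injective (trans e (sym e')))

  -- The pending threads of M' never lie where unlabel is undefined.
  Unlabelled : Loc (Γ' M k) → Set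
  Unlabelled x = unlabel x ≡ nothing

  unlabel-off : ∀ {m f j} → toℕ f ≢ j → Unlabelled ((m , f) ∷ [] , j)
  unlabel-off {f = f} {j} ne with toℕ f ≟ j
  ... | yes e = ⊥-elim (ne e)
  ... | no _ = refl

  labelled : ∀ {m f j} → toℕ f ≡ j → ¬ Unlabelled ((m , f) ∷ [] , j)
  labelled e u with () ← trans (sym (unlabel-at e)) u

  initial-unlabel : unlabel ((just γ₀ , fzero) ∷ [] , 0) ≡ just (γ₀ ∷ [] , 0)
  initial-unlabel = unlabel-at {m = just γ₀} {f = fzero} refl

  initial-labelled : ¬ Unlabelled ((just γ₀ , fzero) ∷ [] , 0)
  initial-labelled u with () ← trans (sym initial-unlabel) u

  pending-letter : ∀ {W W' m f w j} → Vanishes Unlabelled W →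
                   AddOne W' ((m , f) ∷ w , j) W → w ≡ [] × toℕ f ≡ j
  pending-letter {w = _ ∷ _} van ad = ⊥-elim (added-outside van ad refl)
  pending-letter {f = f} {[]} {j} van ad with toℕ f ≟ j
  ... | yes e = refl , e
  ... | no ne = ⊥-elim (added-outside van ad (unlabel-off ne))

  label : Loc Γ → Maybe (Loc (Γ' M k))
  label (w , i) with i <? suc (suc k)
  label ([] , i) | yes i<N = just ((nothing , fromℕ< i<N) ∷ [] , i)
  label (a ∷ [] , i) | yes i<N = just ((just a , fromℕ< i<N) ∷ [] , i)
  label (_ ∷ _ ∷ _ , _) | yes _ = nothing
  label _ | no _ = nothing

  label-at : ∀ {m f i} → toℕ f ≡ i → label (stack m , i) ≡ just ((m , f) ∷ [] , i)
  label-at {nothing} {f} refl with toℕ f <? suc (suc k)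
  ... | yes p = cong (λ g → just ((nothing , g) ∷ [] , toℕ f)) (fromℕ<-toℕ f p)
  ... | no np = ⊥-elim (np (toℕ<n f))
  label-at {just a} {f} refl with toℕ f <? suc (suc k)
  ... | yes p = cong (λ g → just ((just a , g) ∷ [] , toℕ f)) (fromℕ<-toℕ f p)
  ... | no np = ⊥-elim (np (toℕ<n f))

  -- label has a total left inverse, hence is injective where defined.
  forget : Loc (Γ' M k) → Loc Γ
  forget ((m , _) ∷ _ , i) = (stack m , i)
  forget ([] , i) = ([] , i)

  forget-label : ∀ {y x} → label y ≡ just x → forget x ≡ y
  forget-label {w , i} dy with i <? suc (suc k)
  forget-label {[] , i} refl | yes _ = refl
  forget-label {_ ∷ [] , i} refl | yes _ = refl

  label-injective : PartialInjective label
  label-injective dy dy' = trans (sym (forget-label dy)) (forget-label dy')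

  data Realises : Config Q (Γ' M k) → Config Q Γ → Set where
    idle : ∀ {q W} → Vanishes Unlabelled W →
           Realises (q , nothing , W) (q , nothing , pull label W)
    active : ∀ {q W m f i} → toℕ f ≡ i → Vanishes Unlabelled W →
             Realises (q , just ((m , f) ∷ [] , i) , W) (q , just (stack m , i) , pull label W)

  backward-step : ∀ {c' d' c} → Realises c' c → Step (M' M k) c' d' →
                  ∃ λ d → Realises d' d × BoundedStep M k c d
  backward-step (active e van) (creation-ε (rule1 {u = u} h r)) =
    _ , active {m = u} e van , creation-ε r , inj₁ (inject₁-level h e)
  backward-step (active e van) (creation-α (rule2 {α = α} h r) ad) =
    _ , active e (vanishes-add van (labelled e') ad) ,
    creation-α r (pull-add label label-injective (label-at {m = just α} e') ad) ,
    inj₁ (inject₁-level h e)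
    where e' = next-level h e
  backward-step (active e van) (interruption (rule3 {u = u} h r) ad) =
    _ , idle (vanishes-add van (labelled e') ad) ,
    interruption r (pull-add label label-injective (label-at {m = u} e') ad) ,
    inj₁ (inject₁-level h e)
    where e' = next-level h e
  backward-step (idle van) (resumption (rule4 h r) ad) with pending-letter van ad
  ... | refl , e =
    _ , active e (vanishes-remove van ad) ,
    resumption r (pull-add label label-injective (label-at e) ad) ,
    inj₂ (inject₁-level h e)

  backward : ∀ q → Reachable (M' M k) q → BoundedReachable M k q
  backward q ((_ , _ , W₀) , W , (refl , refl , initial) , run)
    with simulate Realises backward-step (idle (vanishes-one initial-labelled initial)) run
  ... | _ , idle _ , run' =
    _ , _ , (refl , refl , pull-one label label-injective (label-at refl) initial) , run'

  data Represents : Config Q Γ → Config Q (Γ' M k) → Set where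
    idle : ∀ {q V} → Vanishes Long V →
           Represents (q , nothing , V) (q , nothing , pull unlabel V)
    active : ∀ {q V m i} (g : Fin (suc k)) → toℕ g ≡ i → Vanishes Long V →
             Represents (q , just (stack m , i) , V)
                        (q , just ((m , inject₁ g) ∷ [] , i) , pull unlabel V)

  forward-step : IsDCFS M → ∀ {c d c'} → Represents c c' → BoundedStep M k c d →
                 ∃ λ d' → Represents d d' × Step (M' M k) c' d'
  forward-step dcfs (active {m = just _} g e van) (creation-ε r , _)
    with short-letter (proj₁ dcfs r)
  ... | _ , refl = _ , active g e van , creation-ε (rule1 g r)
  forward-step dcfs (active {m = just _} g e van) (creation-α r ad , _)
    with short-letter (proj₁ dcfs r)
  ... | _ , refl =
    _ , active g e (vanishes-add van (λ ()) ad) ,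
    creation-α (rule2 g r) (pull-add unlabel unlabel-injective (unlabel-at (cong suc e)) ad)
  forward-step dcfs (active {m = just _} g e van) (interruption r ad , _)
    with short-letter (proj₂ dcfs r)
  ... | _ , refl =
    _ , idle (vanishes-add van stack-short ad) ,
    interruption (rule3 g r) (pull-add unlabel unlabel-injective (unlabel-at (cong suc e)) ad)
  forward-step dcfs (idle van) (resumption r ad , inj₂ i≤k)
    with pending-short van ad | in-range i≤k
  ... | refl | value-of g =
    _ , active g refl (vanishes-remove van ad) ,
    resumption (rule4 g r) (pull-add unlabel unlabel-injective (unlabel-at (toℕ-inject₁ g)) ad)

  forward : IsDCFS M → ∀ q → BoundedReachable M k q → Reachable (M' M k) q
  forward dcfs q ((_ , _ , V₀) , V , (refl , refl , initial) , run)
    with simulate Represents (forward-step dcfs) (idle (vanishes-one (λ ()) initial)) run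
  ... | _ , idle _ , run' =
    _ , _ , (refl , refl , pull-one unlabel unlabel-injective initial-unlabel initial) , run'

lemma3p3 : {Q Γ : Set} → Finite Q → Finite Γ →
           (M : DCPS Q Γ) → IsDCFS M → (k : ℕ) → (q : Q) →
           BoundedReachable M k q ⇔ Reachable (M' M k) q
lemma3p3 _ _ M dcfs k q =
  mk⇔ (Construction.forward M k dcfs q) (Construction.backward M k q)
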